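{- \begin{align*} [x:=[e]]p &\equiv \exists y((e\hookrightarrow y)\wedge [x:=y]p), \tag{E5}\\ [[x]:=e]p &\equiv (x\hookrightarrow -)\wedge [\langle x\rangle:=e]p \;\equiv\; (x\mapsto -)\mathrel{*}((x\mapsto e)\mathrel{ -\!\!*}p), \tag{E6}\\ [x:=\mathbf{cons}(e)]p &\equiv \forall x(\neg(x\hookrightarrow -)\to [\langle x\rangle:=e]p) \;\equiv\; \forall x((x\mapsto e)\mathrel{ -\!\!*}p), \tag{E7}\\ [\mathbf{dispose}(x)]p &\equiv (x\hookrightarrow -)\wedge [\langle x\rangle:=\bot]p \;\equiv\; (x\mapsto -)\mathrel{*}p, \tag{E8} \end{align*} where $y$ is fresh in (E5), and in (E7) it is required that $x$ does not appear in $e$.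
   Context: Setting (Dynamic Separation Logic, DSL). Heaps $h$ are finitely-based partial functions $\mathbb{Z}\rightharpoonup\mathbb{Z}$, stores $s$ total functions from integer variables to $\mathbb{Z}$; expressions $e,b$ do not refer to the heap. $h[n:=v]$ sets location $n$ to $v$ (extending the domain if needed) and $h[n:=\bot]$ removes $n$ from the domain. Assertions include Boolean expressions, $(e\hookrightarrow e')$ (true iff $s(e)\in\mathrm{dom}(h)$ and $h(s(e))=s(e')$), logical connectives, quantifiers, separating conjunction $\mathrel{*}$ (disjoint heap split), separating implication $\mathrel{ -\!\!*}$ (for every disjoint extension satisfying the antecedent, the combined heap satisfies the consequent), and modalities $[S]p$ (execution of $S$ does not fail and every final state satisfies $p$). Abbreviations: $(e\hookrightarrow -)$ is $\exists z(e\hookrightarrow z)$; $(e\mapsto e')$ is $(e\hookrightarrow e')\wedge\forall z((z\hookrightarrow -)\to z=e)$ (heap is exactly the single cell $s(e)$ containing $s(e')$); $(e\mapsto -)$ is $\exists z(e\mapsto z)$. Instructions: $x:=e$ gives $(h,s[x:=s(e)])$; look-up $x:=[e]$ fails if $s(e)\notin\mathrm{dom}(h)$, else gives $(h,s[x:=h(s(e))])$; mutation $[x]:=e$ fails if $s(x)\notin\mathrm{dom}(h)$, else gives $(h[s(x):=s(e)],s)$; allocation $x:=\mathbf{cons}(e)$ gives $(h[n:=s(e)],s[x:=n])$ for any $n\notin\mathrm{dom}(h)$; $\mathbf{dispose}(x)$ fails if $s(x)\notin\mathrm{dom}(h)$, else gives $(h[s(x):=\bot],s)$. Pseudo-instructions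 (never failing): heap update $\langle x\rangle:=e$ gives $(h[s(x):=s(e)],s)$; heap clear $\langle x\rangle:=\bot$ gives $(h[s(x):=\bot],s)$. $\equiv$ denotes semantic equivalence. -}

module Defs where

open import Data.Nat as ℕ using (ℕ; _⊔_)
open import Data.Integer as ℤ using (ℤ)
open import Data.Bool using (Bool; true; false; if_then_else_; not; _∧_; _∨_; T)
open import Data.Maybe using (Maybe; just; nothing)
open import Data.List using (List; []; _∷_; _++_; foldr)
open import Data.List.Membership.Propositional using (_∈_; _∉_)
open import Data.Product using (Σ; _×_; _,_)
open import Data.Sum using (_⊎_)
open import Data.Empty using (⊥; ⊥-elim)
open import Relation.Nullary using (¬_; does; yes; no)
open import Relation.Binary.PropositionalEquality using (_≡_; _≢_; refl)
open import Data.List.Relation.Unary.Any using (here; there)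

Var : Set
Var = ℕ

Store : Set
Store = Var → ℤ

_[_≔_]ˢ : Store → Var → ℤ → Store
(s [ x ≔ v ]ˢ) y = if does (y ℕ.≟ x) then v else s y

record Heap : Set where
  field
    fun     : ℤ → Maybe ℤ
    support : List ℤ
    finite  : ∀ n → n ∉ support → fun n ≡ nothing
open Heap public

_∈dom_ : ℤ → Heap → Set
n ∈dom h = fun h n ≢ nothing

upd : Heap → ℤ → ℤ → Heap
fun (upd h n v) m = if does (m ℤ.≟ n) then just v else fun h m
support (upd h n v) = n ∷ support h
finite (upd h n v) m m∉ with m ℤ.≟ n
... | yes m≡n = ⊥-elim (m∉ (here m≡n))
... | no _ = finite h m (λ m∈ → m∉ (there m∈))

clr : Heap → ℤ → Heap
fun (clr h n) m = if does (m ℤ.≟ n) then nothing else fun h m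
support (clr h n) = support h
finite (clr h n) m m∉ with m ℤ.≟ n
... | yes _ = refl
... | no _ = finite h m m∉

Disjoint : Heap → Heap → Set
Disjoint h₁ h₂ = ∀ n → fun h₁ n ≡ nothing ⊎ fun h₂ n ≡ nothing

unionM : Maybe ℤ → Maybe ℤ → Maybe ℤ
unionM (just v) _ = just v
unionM nothing m = m

Split : Heap → Heap → Heap → Set
Split h h₁ h₂ = Disjoint h₁ h₂ × (∀ n → fun h n ≡ unionM (fun h₁ n) (fun h₂ n))

data Expr : Set where
  num  : ℤ → Expr
  var  : Var → Expr
  _⊕_  : Expr → Expr → Expr
  _⊖_  : Expr → Expr → Expr
  _⊗_  : Expr → Expr → Expr

data BExp : Set where
  btrue bfalse : BExp
  _==_ _≤ᵇ_    : Expr → Expr → BExp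
  bnot         : BExp → BExp
  _band_ _bor_ : BExp → BExp → BExp

⟦_⟧ : Expr → Store → ℤ
⟦ num n ⟧ s = n
⟦ var x ⟧ s = s x
⟦ e ⊕ e' ⟧ s = ⟦ e ⟧ s ℤ.+ ⟦ e' ⟧ s
⟦ e ⊖ e' ⟧ s = ⟦ e ⟧ s ℤ.- ⟦ e' ⟧ s
⟦ e ⊗ e' ⟧ s = ⟦ e ⟧ s ℤ.* ⟦ e' ⟧ s

⟦_⟧ᵇ : BExp → Store → Bool
⟦ btrue ⟧ᵇ s = true
⟦ bfalse ⟧ᵇ s = false
⟦ e == e' ⟧ᵇ s = does (⟦ e ⟧ s ℤ.≟ ⟦ e' ⟧ s)
⟦ e ≤ᵇ e' ⟧ᵇ s = does (⟦ e ⟧ s ℤ.≤? ⟦ e' ⟧ s)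
⟦ bnot b ⟧ᵇ s = not (⟦ b ⟧ᵇ s)
⟦ b band b' ⟧ᵇ s = ⟦ b ⟧ᵇ s ∧ ⟦ b' ⟧ᵇ s
⟦ b bor b' ⟧ᵇ s = ⟦ b ⟧ᵇ s ∨ ⟦ b' ⟧ᵇ s

varsE : Expr → List Var
varsE (num _) = []
varsE (var x) = x ∷ []
varsE (e ⊕ e') = varsE e ++ varsE e'
varsE (e ⊖ e') = varsE e ++ varsE e'
varsE (e ⊗ e') = varsE e ++ varsE e'

varsB : BExp → List Var
varsB btrue = []
varsB bfalse = []
varsB (e == e') = varsE e ++ varsE e'
varsB (e ≤ᵇ e') = varsE e ++ varsE e'
varsB (bnot b) = varsB b
varsB (b band b') = varsB b ++ varsB b'
varsB (b bor b') = varsB b ++ varsB b'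

data Cmd : Set where
  skip     : Cmd
  _≔_      : Var → Expr → Cmd
  _≔[_]    : Var → Expr → Cmd
  [_]≔_    : Var → Expr → Cmd
  _≔cons_  : Var → Expr → Cmd
  dispose  : Var → Cmd
  ⟨_⟩≔_    : Var → Expr → Cmd
  ⟨_⟩≔⊥    : Var → Cmd
  _⨾_      : Cmd → Cmd → Cmd
  ifc_then_else_ : BExp → Cmd → Cmd → Cmd
  while_loop_ : BExp → Cmd → Cmd

varsC : Cmd → List Var
varsC skip = []
varsC (x ≔ e) = x ∷ varsE e
varsC (x ≔[ e ]) = x ∷ varsE e
varsC ([ x ]≔ e) = x ∷ varsE e
varsC (x ≔cons e) = x ∷ varsE e
varsC (dispose x) = x ∷ []
varsC (⟨ x ⟩≔ e) = x ∷ varsE e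
varsC ⟨ x ⟩≔⊥ = x ∷ []
varsC (S ⨾ T) = varsC S ++ varsC T
varsC (ifc b then S else T) = varsB b ++ varsC S ++ varsC T
varsC (while b loop S) = varsB b ++ varsC S

data Outcome : Set where
  fail : Outcome
  ok   : Heap → Store → Outcome

data Exec : Cmd → Heap → Store → Outcome → Set where
  e-skip    : ∀ {h s} → Exec skip h s (ok h s)
  e-assign  : ∀ {x e h s} → Exec (x ≔ e) h s (ok h (s [ x ≔ ⟦ e ⟧ s ]ˢ))
  e-lookup  : ∀ {x e h s v} → fun h (⟦ e ⟧ s) ≡ just v →
              Exec (x ≔[ e ]) h s (ok h (s [ x ≔ v ]ˢ))
  e-lookupF : ∀ {x e h s} → fun h (⟦ e ⟧ s) ≡ nothing → Exec (x ≔[ e ]) h s fail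
  e-mut     : ∀ {x e h s} → s x ∈dom h → Exec ([ x ]≔ e) h s (ok (upd h (s x) (⟦ e ⟧ s)) s)
  e-mutF    : ∀ {x e h s} → fun h (s x) ≡ nothing → Exec ([ x ]≔ e) h s fail
  e-cons    : ∀ {x e h s n} → fun h n ≡ nothing →
              Exec (x ≔cons e) h s (ok (upd h n (⟦ e ⟧ s)) (s [ x ≔ n ]ˢ))
  e-disp    : ∀ {x h s} → s x ∈dom h → Exec (dispose x) h s (ok (clr h (s x)) s)
  e-dispF   : ∀ {x h s} → fun h (s x) ≡ nothing → Exec (dispose x) h s fail
  e-hupd    : ∀ {x e h s} → Exec (⟨ x ⟩≔ e) h s (ok (upd h (s x) (⟦ e ⟧ s)) s)
  e-hclr    : ∀ {x h s} → Exec ⟨ x ⟩≔⊥ h s (ok (clr h (s x)) s)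
  e-seq     : ∀ {S T h s h' s' o} → Exec S h s (ok h' s') → Exec T h' s' o → Exec (S ⨾ T) h s o
  e-seqF    : ∀ {S T h s} → Exec S h s fail → Exec (S ⨾ T) h s fail
  e-ifT     : ∀ {b S S' h s o} → T (⟦ b ⟧ᵇ s) → Exec S h s o → Exec (ifc b then S else S') h s o
  e-ifF     : ∀ {b S S' h s o} → T (not (⟦ b ⟧ᵇ s)) → Exec S' h s o → Exec (ifc b then S else S') h s o
  e-whileF  : ∀ {b S h s} → T (not (⟦ b ⟧ᵇ s)) → Exec (while b loop S) h s (ok h s)
  e-whileT  : ∀ {b S h s h' s' o} → T (⟦ b ⟧ᵇ s) → Exec S h s (ok h' s') →
              Exec (while b loop S) h' s' o → Exec (while b loop S) h s o
  e-whileTF : ∀ {b S h s} → T (⟦ b ⟧ᵇ s) → Exec S h s fail → Exec (while b loop S) h s fail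

data Assn : Set where
  bool  : BExp → Assn
  _↪_   : Expr → Expr → Assn
  ¬ᵃ_   : Assn → Assn
  _∧ᵃ_ _∨ᵃ_ _⇒ᵃ_ : Assn → Assn → Assn
  ∃ᵃ ∀ᵃ : Var → Assn → Assn
  _✶_   : Assn → Assn → Assn
  _-✶_  : Assn → Assn → Assn
  [_]_  : Cmd → Assn → Assn

_⊨_ : Heap × Store → Assn → Set
(h , s) ⊨ bool b = T (⟦ b ⟧ᵇ s)
(h , s) ⊨ (e ↪ e') = fun h (⟦ e ⟧ s) ≡ just (⟦ e' ⟧ s)
(h , s) ⊨ (¬ᵃ p) = ¬ ((h , s) ⊨ p)
(h , s) ⊨ (p ∧ᵃ q) = (h , s) ⊨ p × (h , s) ⊨ q
(h , s) ⊨ (p ∨ᵃ q) = (h , s) ⊨ p ⊎ (h , s) ⊨ q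
(h , s) ⊨ (p ⇒ᵃ q) = (h , s) ⊨ p → (h , s) ⊨ q
(h , s) ⊨ ∃ᵃ x p = Σ ℤ λ v → (h , s [ x ≔ v ]ˢ) ⊨ p
(h , s) ⊨ ∀ᵃ x p = ∀ (v : ℤ) → (h , s [ x ≔ v ]ˢ) ⊨ p
(h , s) ⊨ (p ✶ q) = Σ Heap λ h₁ → Σ Heap λ h₂ →
                      Split h h₁ h₂ × (h₁ , s) ⊨ p × (h₂ , s) ⊨ q
(h , s) ⊨ (p -✶ q) = ∀ (h' h'' : Heap) → Split h'' h h' → (h' , s) ⊨ p → (h'' , s) ⊨ q
(h , s) ⊨ ([ S ] p) = ¬ Exec S h s fail × (∀ h' s' → Exec S h s (ok h' s') → (h' , s') ⊨ p)

_≣_ : Assn → Assn → Set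
p ≣ q = ∀ h s → ((h , s) ⊨ p → (h , s) ⊨ q) × ((h , s) ⊨ q → (h , s) ⊨ p)

NotFree : Var → Assn → Set
NotFree y (bool b) = y ∉ varsB b
NotFree y (e ↪ e') = y ∉ varsE e × y ∉ varsE e'
NotFree y (¬ᵃ p) = NotFree y p
NotFree y (p ∧ᵃ q) = NotFree y p × NotFree y q
NotFree y (p ∨ᵃ q) = NotFree y p × NotFree y q
NotFree y (p ⇒ᵃ q) = NotFree y p × NotFree y q
NotFree y (∃ᵃ x p) = y ≡ x ⊎ NotFree y p
NotFree y (∀ᵃ x p) = y ≡ x ⊎ NotFree y p
NotFree y (p ✶ q) = NotFree y p × NotFree y q
NotFree y (p -✶ q) = NotFree y p × NotFree y q
NotFree y ([ S ] p) = y ∉ varsC S × NotFree y p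

freshFor : List Var → Var
freshFor xs = ℕ.suc (foldr _⊔_ 0 xs)

_↪- : Expr → Assn
e ↪- = ∃ᵃ z (e ↪ var z)
  where z = freshFor (varsE e)

_↦_ : Expr → Expr → Assn
e ↦ e' = (e ↪ e') ∧ᵃ ∀ᵃ z ((var z ↪-) ⇒ᵃ bool (var z == e))
  where z = freshFor (varsE e ++ varsE e')

_↦- : Expr → Assn
e ↦- = ∃ᵃ z (e ↦ var z)
  where z = freshFor (varsE e)

{-# OPTIONS --safe #-}
-- Each side of (E5)–(E8) is reduced to a condition on the concrete heap. The box of an
-- instruction is read off its execution rules; a heap satisfies (e ↦ v) exactly when it is
-- pointwise equal to the one-cell heap, so splitting off (x ↦ -) with ✶ amounts to clearing
-- the cell at x, and a magic wand against (x ↦ e) to writing that cell when it is free.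
-- Since upd and clr record the touched address in the support, the heaps arising this way are
-- only pointwise equal, so satisfaction is first shown invariant under pointwise heap equality
-- and under changes of the store on variables that are not free.
module Submission where

open import Defs
open import Data.Bool using (T; if_then_else_; not; _∧_; _∨_)
open import Data.Empty using (⊥; ⊥-elim)
open import Data.Integer as ℤ using (ℤ)
open import Data.List using (List; []; _∷_; _++_; foldr)
open import Data.List.Membership.Propositional using (_∈_; _∉_)
open import Data.List.Membership.Propositional.Properties using (∈-++⁺ˡ; ∈-++⁺ʳ)
open import Data.List.Relation.Unary.Any using (here; there)
open import Data.Maybe using (Maybe; just; nothing)
open import Data.Nat as ℕ using (_⊔_)
open import Data.Nat.Properties using (m≤m⊔n; m≤n⊔m; ≤-trans; <-irrefl)
open import Data.Product using (∃; _×_; _,_; proj₁; proj₂)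
open import Data.Product.Function.Dependent.Propositional using (congˡ)
open import Data.Product.Function.NonDependent.Propositional using (_×-⇔_)
open import Data.Sum using (_⊎_; inj₁; inj₂; swap; map₁)
open import Data.Unit using (⊤; tt)
open import Function.Base using (_∘_)
open import Function.Bundles using (_⇔_; mk⇔; Equivalence)
open import Function.Construct.Identity using (⇔-id)
open import Function.Properties.Equivalence using (⇔-setoid)
open import Function.Related.Propositional using (Kind; ≡⇒)
open import Function.Related.TypeIsomorphisms using (→-cong-⇔; ¬-cong-⇔)
open import Level using (0ℓ)
open import Relation.Binary.PropositionalEquality using (_≡_; _≢_; refl; sym; trans; cong; cong₂; subst)
open import Relation.Nullary using (¬_; Dec; does; yes; no)
open import Relation.Nullary.Decidable using (dec-true; dec-false)
open import Relation.Binary.Reasoning.Setoid (⇔-setoid 0ℓ)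

open Equivalence using (to; from)

⇔-directions : ∀ {A B : Set} → A ⇔ B → (A → B) × (B → A)
⇔-directions A⇔B = to A⇔B , from A⇔B

≡⇒⇔ : ∀ {A B : Set} → A ≡ B → A ⇔ B
≡⇒⇔ = ≡⇒ {k = Kind.equivalence}

∃-cong-⇔ : ∀ {I : Set} {A B : I → Set} → (∀ v → A v ⇔ B v) → ∃ A ⇔ ∃ B
∃-cong-⇔ A⇔B = congˡ {k = Kind.equivalence} λ {v} → A⇔B v

∀-cong-⇔ : ∀ {I : Set} {A B : I → Set} → (∀ v → A v ⇔ B v) → (∀ v → A v) ⇔ (∀ v → B v)
∀-cong-⇔ A⇔B = mk⇔ (λ f v → to (A⇔B v) (f v)) (λ g v → from (A⇔B v) (g v))

T-does⇔ : ∀ {A : Set} (d : Dec A) → T (does d) ⇔ A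
T-does⇔ (yes a) = mk⇔ (λ _ → a) (λ _ → tt)
T-does⇔ (no ¬a) = mk⇔ (λ ()) ¬a

≢nothing⇔just : ∀ {A : Set} (m : Maybe A) → (m ≢ nothing) ⇔ (∃ λ v → m ≡ just v)
≢nothing⇔just (just v) = mk⇔ (λ _ → v , refl) (λ _ ())
≢nothing⇔just nothing = mk⇔ (λ m≢nothing → ⊥-elim (m≢nothing refl)) (λ ())

¬≢nothing⇔nothing : ∀ {A : Set} (m : Maybe A) → (¬ m ≢ nothing) ⇔ (m ≡ nothing)
¬≢nothing⇔nothing (just v) = mk⇔ (λ ¬m≢nothing → ⊥-elim (¬m≢nothing λ ())) (λ ())
¬≢nothing⇔nothing nothing = mk⇔ (λ _ → refl) (λ _ m≢nothing → m≢nothing refl)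

just⇒≢nothing : ∀ {A : Set} {m : Maybe A} {v} → m ≡ just v → m ≢ nothing
just⇒≢nothing refl ()

-- Stores and variables

[≔]ˢ-same : ∀ (s : Store) x v → (s [ x ≔ v ]ˢ) x ≡ v
[≔]ˢ-same s x v = cong (if_then v else s x) (dec-true (x ℕ.≟ x) refl)

[≔]ˢ-other : ∀ (s : Store) {x y} v → y ≢ x → (s [ x ≔ v ]ˢ) y ≡ s y
[≔]ˢ-other s {x} {y} v y≢x = cong (if_then v else s y) (dec-false (y ℕ.≟ x) y≢x)

record AgreeOutside (I : Var → Set) (s s' : Store) : Set where
  constructor mkAgree
  field agree : ∀ z → ¬ I z → s z ≡ s' z
open AgreeOutside

agree-sym : ∀ {I s s'} → AgreeOutside I s s' → AgreeOutside I s' s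
agree-sym ag = mkAgree λ z z∉I → sym (agree ag z z∉I)

agree-mono : ∀ {I J s s'} → (∀ {z} → J z → I z) → AgreeOutside J s s' → AgreeOutside I s s'
agree-mono J⊆I ag = mkAgree λ z z∉I → agree ag z (λ z∈J → z∉I (J⊆I z∈J))

agree-update : ∀ {I s s' x a b} → a ≡ b → AgreeOutside I s s' →
  AgreeOutside (λ z → I z × z ≢ x) (s [ x ≔ a ]ˢ) (s' [ x ≔ b ]ˢ)
agree-update {I} {s} {s'} {x} {a} {b} a≡b ag = mkAgree at
  where
  at : ∀ z → ¬ (I z × z ≢ x) → (s [ x ≔ a ]ˢ) z ≡ (s' [ x ≔ b ]ˢ) z
  at z z∉ with z ℕ.≟ x
  ... | yes refl = trans ([≔]ˢ-same s x a) (trans a≡b (sym ([≔]ˢ-same s' x b)))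
  ... | no z≢x = trans ([≔]ˢ-other s a z≢x)
                   (trans (agree ag z (λ z∈I → z∉ (z∈I , z≢x))) (sym ([≔]ˢ-other s' b z≢x)))

agree-[≔] : ∀ {I s s' x a b} → a ≡ b → AgreeOutside I s s' →
  AgreeOutside I (s [ x ≔ a ]ˢ) (s' [ x ≔ b ]ˢ)
agree-[≔] a≡b = agree-mono proj₁ ∘ agree-update a≡b

agree-[≔]ˢ : ∀ (s : Store) y v → AgreeOutside (_≡ y) s (s [ y ≔ v ]ˢ)
agree-[≔]ˢ s y v = mkAgree λ z z≢y → sym ([≔]ˢ-other s v z≢y)

Absent : (Var → Set) → List Var → Set
Absent I xs = ∀ {y} → I y → y ∉ xs

absent-++ˡ : ∀ {I} {xs ys : List Var} → Absent I (xs ++ ys) → Absent I xs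
absent-++ˡ a y∈I y∈xs = a y∈I (∈-++⁺ˡ y∈xs)

absent-++ʳ : ∀ {I} (xs : List Var) {ys} → Absent I (xs ++ ys) → Absent I ys
absent-++ʳ xs a y∈I y∈ys = a y∈I (∈-++⁺ʳ xs y∈ys)

absent-tail : ∀ {I x} {xs : List Var} → Absent I (x ∷ xs) → Absent I xs
absent-tail a y∈I y∈xs = a y∈I (there y∈xs)

absent-head : ∀ {I x} {xs : List Var} → Absent I (x ∷ xs) → ¬ I x
absent-head a x∈I = a x∈I (here refl)

eval-agree : ∀ {I s s'} e → Absent I (varsE e) → AgreeOutside I s s' → ⟦ e ⟧ s ≡ ⟦ e ⟧ s'
eval-agree (num n) a ag = refl
eval-agree (var x) a ag = agree ag x (absent-head a)
eval-agree (e ⊕ e') a ag = cong₂ ℤ._+_ (eval-agree e (absent-++ˡ a) ag) (eval-agree e' (absent-++ʳ (varsE e) a) ag)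
eval-agree (e ⊖ e') a ag = cong₂ ℤ._-_ (eval-agree e (absent-++ˡ a) ag) (eval-agree e' (absent-++ʳ (varsE e) a) ag)
eval-agree (e ⊗ e') a ag = cong₂ ℤ._*_ (eval-agree e (absent-++ˡ a) ag) (eval-agree e' (absent-++ʳ (varsE e) a) ag)

evalᵇ-agree : ∀ {I s s'} b → Absent I (varsB b) → AgreeOutside I s s' → ⟦ b ⟧ᵇ s ≡ ⟦ b ⟧ᵇ s'
evalᵇ-agree btrue a ag = refl
evalᵇ-agree bfalse a ag = refl
evalᵇ-agree (e == e') a ag =
  cong₂ (λ m n → does (m ℤ.≟ n)) (eval-agree e (absent-++ˡ a) ag) (eval-agree e' (absent-++ʳ (varsE e) a) ag)
evalᵇ-agree (e ≤ᵇ e') a ag =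
  cong₂ (λ m n → does (m ℤ.≤? n)) (eval-agree e (absent-++ˡ a) ag) (eval-agree e' (absent-++ʳ (varsE e) a) ag)
evalᵇ-agree (bnot b) a ag = cong not (evalᵇ-agree b a ag)
evalᵇ-agree (b band b') a ag =
  cong₂ _∧_ (evalᵇ-agree b (absent-++ˡ a) ag) (evalᵇ-agree b' (absent-++ʳ (varsB b) a) ag)
evalᵇ-agree (b bor b') a ag =
  cong₂ _∨_ (evalᵇ-agree b (absent-++ˡ a) ag) (evalᵇ-agree b' (absent-++ʳ (varsB b) a) ag)

eval-[≔]-fresh : ∀ e (s : Store) {y} v → y ∉ varsE e → ⟦ e ⟧ (s [ y ≔ v ]ˢ) ≡ ⟦ e ⟧ s
eval-[≔]-fresh e s {y} v y∉e = sym (eval-agree e (λ { refl → y∉e }) (agree-[≔]ˢ s y v))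

∈⇒≤foldr-⊔ : ∀ {y} xs → y ∈ xs → y ℕ.≤ foldr _⊔_ 0 xs
∈⇒≤foldr-⊔ (x ∷ xs) (here refl) = m≤m⊔n x _
∈⇒≤foldr-⊔ (x ∷ xs) (there y∈xs) = ≤-trans (∈⇒≤foldr-⊔ xs y∈xs) (m≤n⊔m x _)

freshFor-∉ : ∀ xs → freshFor xs ∉ xs
freshFor-∉ xs fresh∈xs = <-irrefl refl (∈⇒≤foldr-⊔ xs fresh∈xs)

-- Heaps

record _≈ʰ_ (h h' : Heap) : Set where
  constructor mk≈ʰ
  field ≈ʰ-at : ∀ n → fun h n ≡ fun h' n
open _≈ʰ_

≈ʰ-refl : ∀ {h} → h ≈ʰ h
≈ʰ-refl = mk≈ʰ λ n → refl

≈ʰ-sym : ∀ {h h'} → h ≈ʰ h' → h' ≈ʰ h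
≈ʰ-sym q = mk≈ʰ λ n → sym (≈ʰ-at q n)

≈ʰ-trans : ∀ {h h' h''} → h ≈ʰ h' → h' ≈ʰ h'' → h ≈ʰ h''
≈ʰ-trans q r = mk≈ʰ λ n → trans (≈ʰ-at q n) (≈ʰ-at r n)

fun-resp : ∀ {h h' a b m} → h ≈ʰ h' → a ≡ b → fun h a ≡ m → fun h' b ≡ m
fun-resp q refl = trans (sym (≈ʰ-at q _))

∈dom-resp : ∀ {h h' a b} → h ≈ʰ h' → a ≡ b → a ∈dom h → b ∈dom h'
∈dom-resp q a≡b a∈h = a∈h ∘ fun-resp (≈ʰ-sym q) (sym a≡b)

upd-cong : ∀ {h h' a a' v v'} → h ≈ʰ h' → a ≡ a' → v ≡ v' → upd h a v ≈ʰ upd h' a' v'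
upd-cong {h} {h'} {a} {v = v} q refl refl = mk≈ʰ at
  where
  at : ∀ n → fun (upd h a v) n ≡ fun (upd h' a v) n
  at n with n ℤ.≟ a
  ... | yes _ = refl
  ... | no _ = ≈ʰ-at q n

clr-cong : ∀ {h h' a a'} → h ≈ʰ h' → a ≡ a' → clr h a ≈ʰ clr h' a'
clr-cong {h} {h'} {a} q refl = mk≈ʰ at
  where
  at : ∀ n → fun (clr h a) n ≡ fun (clr h' a) n
  at n with n ℤ.≟ a
  ... | yes _ = refl
  ... | no _ = ≈ʰ-at q n

upd-self : ∀ h a v → fun (upd h a v) a ≡ just v
upd-self h a v = cong (if_then just v else fun h a) (dec-true (a ℤ.≟ a) refl)

clr-self : ∀ h a → fun (clr h a) a ≡ nothing
clr-self h a = cong (if_then nothing else fun h a) (dec-true (a ℤ.≟ a) refl)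

upd-clr : ∀ h a v → upd (clr h a) a v ≈ʰ upd h a v
upd-clr h a v = mk≈ʰ at
  where
  at : ∀ n → fun (upd (clr h a) a v) n ≡ fun (upd h a v) n
  at n with n ℤ.≟ a
  ... | yes _ = refl
  ... | no _ = refl

clr-upd : ∀ {h a} v → fun h a ≡ nothing → clr (upd h a v) a ≈ʰ h
clr-upd {h} {a} v h[a]≡nothing = mk≈ʰ at
  where
  at : ∀ n → fun (clr (upd h a v) a) n ≡ fun h n
  at n with n ℤ.≟ a
  ... | yes refl = sym h[a]≡nothing
  ... | no _ = refl

∅ʰ : Heap
fun ∅ʰ _ = nothing
support ∅ʰ = []
finite ∅ʰ _ _ = refl

_↦ʰ_ : ℤ → ℤ → Heap
a ↦ʰ v = upd ∅ʰ a v

unionM-identityʳ : ∀ m → unionM m nothing ≡ m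
unionM-identityʳ (just _) = refl
unionM-identityʳ nothing = refl

unionM-comm : ∀ {m m'} → m ≡ nothing ⊎ m' ≡ nothing → unionM m m' ≡ unionM m' m
unionM-comm (inj₁ refl) = sym (unionM-identityʳ _)
unionM-comm (inj₂ refl) = unionM-identityʳ _

split-comm : ∀ {h h₁ h₂} → Split h h₁ h₂ → Split h h₂ h₁
split-comm (disj , un) = (λ n → swap (disj n)) , λ n → trans (un n) (unionM-comm (disj n))

split-resp : ∀ {h h' h₁ h₂} → h ≈ʰ h' → Split h h₁ h₂ → Split h' h₁ h₂
split-resp q (disj , un) = disj , λ n → trans (sym (≈ʰ-at q n)) (un n)

split-respˡ : ∀ {h h₁ h₁' h₂} → h₁ ≈ʰ h₁' → Split h h₁ h₂ → Split h h₁' h₂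
split-respˡ {h₂ = h₂} q (disj , un) =
  (λ n → map₁ (trans (sym (≈ʰ-at q n))) (disj n)) ,
  λ n → trans (un n) (cong (λ m → unionM m (fun h₂ n)) (≈ʰ-at q n))

split-upd : ∀ {h a} v → fun h a ≡ nothing → Split (upd h a v) h (a ↦ʰ v)
split-upd {h} {a} v h[a]≡nothing = disj , un
  where
  disj : Disjoint h (a ↦ʰ v)
  disj n with n ℤ.≟ a
  ... | yes refl = inj₁ h[a]≡nothing
  ... | no _ = inj₂ refl
  un : ∀ n → fun (upd h a v) n ≡ unionM (fun h n) (fun (a ↦ʰ v) n)
  un n with n ℤ.≟ a
  ... | yes refl = cong (λ m → unionM m (just v)) (sym h[a]≡nothing)
  ... | no _ = sym (unionM-identityʳ _)

split-clr : ∀ {h a w} → fun h a ≡ just w → Split h (a ↦ʰ w) (clr h a)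
split-clr {h} {a} {w} h[a]≡w = disj , un
  where
  disj : Disjoint (a ↦ʰ w) (clr h a)
  disj n with n ℤ.≟ a
  ... | yes _ = inj₂ refl
  ... | no _ = inj₁ refl
  un : ∀ n → fun h n ≡ unionM (fun (a ↦ʰ w) n) (fun (clr h a) n)
  un n with n ℤ.≟ a
  ... | yes refl = h[a]≡w
  ... | no _ = refl

split-singletonʳ : ∀ {h h₁ h₂ a v} → Split h h₁ h₂ → h₂ ≈ʰ (a ↦ʰ v) →
  fun h₁ a ≡ nothing × h ≈ʰ upd h₁ a v
split-singletonʳ {h} {h₁} {h₂} {a} {v} (disj , un) h₂≈ = h₁[a]≡nothing , mk≈ʰ at
  where
  h₁[a]≡nothing : fun h₁ a ≡ nothing
  h₁[a]≡nothing with disj a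
  ... | inj₁ h₁[a] = h₁[a]
  ... | inj₂ h₂[a] with trans (sym h₂[a]) (trans (≈ʰ-at h₂≈ a) (upd-self ∅ʰ a v))
  ... | ()
  at : ∀ n → fun h n ≡ fun (upd h₁ a v) n
  at n with n ℤ.≟ a | trans (un n) (cong (unionM (fun h₁ n)) (≈ʰ-at h₂≈ n))
  ... | yes refl | h[n] = trans h[n] (cong (λ m → unionM m (just v)) h₁[a]≡nothing)
  ... | no _ | h[n] = trans h[n] (unionM-identityʳ _)

-- Coincidence

Similar : (Var → Set) → Outcome → Outcome → Set
Similar I fail fail = ⊤
Similar I (ok h s) (ok h' s') = h ≈ʰ h' × AgreeOutside I s s'
Similar I _ _ = ⊥

exec-cong : ∀ {I S h h' s s' o} → Absent I (varsC S) → h ≈ʰ h' → AgreeOutside I s s' →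
  Exec S h s o → ∃ λ o' → Exec S h' s' o' × Similar I o o'
exec-cong a q ag e-skip = _ , e-skip , q , ag
exec-cong {S = x ≔ e} a q ag e-assign = _ , e-assign , q , agree-[≔] (eval-agree e (absent-tail a) ag) ag
exec-cong {S = x ≔[ e ]} a q ag (e-lookup h[e]≡v) =
  _ , e-lookup (fun-resp q (eval-agree e (absent-tail a) ag) h[e]≡v) , q , agree-[≔] refl ag
exec-cong {S = x ≔[ e ]} a q ag (e-lookupF h[e]≡nothing) =
  _ , e-lookupF (fun-resp q (eval-agree e (absent-tail a) ag) h[e]≡nothing) , tt
exec-cong {S = [ x ]≔ e} a q ag (e-mut x∈h) =
  _ , e-mut (∈dom-resp q (agree ag x (absent-head a)) x∈h) ,
  upd-cong q (agree ag x (absent-head a)) (eval-agree e (absent-tail a) ag) , ag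
exec-cong {S = [ x ]≔ e} a q ag (e-mutF h[x]≡nothing) =
  _ , e-mutF (fun-resp q (agree ag x (absent-head a)) h[x]≡nothing) , tt
exec-cong {S = x ≔cons e} a q ag (e-cons h[n]≡nothing) =
  _ , e-cons (fun-resp q refl h[n]≡nothing) , upd-cong q refl (eval-agree e (absent-tail a) ag) , agree-[≔] refl ag
exec-cong {S = dispose x} a q ag (e-disp x∈h) =
  _ , e-disp (∈dom-resp q (agree ag x (absent-head a)) x∈h) , clr-cong q (agree ag x (absent-head a)) , ag
exec-cong {S = dispose x} a q ag (e-dispF h[x]≡nothing) =
  _ , e-dispF (fun-resp q (agree ag x (absent-head a)) h[x]≡nothing) , tt
exec-cong {S = ⟨ x ⟩≔ e} a q ag e-hupd =
  _ , e-hupd , upd-cong q (agree ag x (absent-head a)) (eval-agree e (absent-tail a) ag) , ag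
exec-cong {S = ⟨ x ⟩≔⊥} a q ag e-hclr = _ , e-hclr , clr-cong q (agree ag x (absent-head a)) , ag
exec-cong {S = S ⨾ S'} a q ag (e-seq d d') with exec-cong (absent-++ˡ a) q ag d
... | ok _ _ , d₁ , q₁ , ag₁ with exec-cong (absent-++ʳ (varsC S) a) q₁ ag₁ d'
...   | o' , d₂ , sim = o' , e-seq d₁ d₂ , sim
exec-cong {S = S ⨾ S'} a q ag (e-seqF d) with exec-cong (absent-++ˡ a) q ag d
... | fail , d₁ , _ = fail , e-seqF d₁ , tt
exec-cong {S = ifc b then S else S'} a q ag (e-ifT b-true d)
  with exec-cong (absent-++ˡ (absent-++ʳ (varsB b) a)) q ag d
... | o' , d₁ , sim = o' , e-ifT (subst T (evalᵇ-agree b (absent-++ˡ a) ag) b-true) d₁ , sim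
exec-cong {S = ifc b then S else S'} a q ag (e-ifF b-false d)
  with exec-cong (absent-++ʳ (varsC S) (absent-++ʳ (varsB b) a)) q ag d
... | o' , d₁ , sim = o' , e-ifF (subst T (cong not (evalᵇ-agree b (absent-++ˡ a) ag)) b-false) d₁ , sim
exec-cong {S = while b loop S} a q ag (e-whileF b-false) =
  _ , e-whileF (subst T (cong not (evalᵇ-agree b (absent-++ˡ a) ag)) b-false) , q , ag
exec-cong {S = while b loop S} a q ag (e-whileT b-true d d') with exec-cong (absent-++ʳ (varsB b) a) q ag d
... | ok _ _ , d₁ , q₁ , ag₁ with exec-cong a q₁ ag₁ d'
...   | o' , d₂ , sim = o' , e-whileT (subst T (evalᵇ-agree b (absent-++ˡ a) ag) b-true) d₁ d₂ , sim
exec-cong {S = while b loop S} a q ag (e-whileTF b-true d) with exec-cong (absent-++ʳ (varsB b) a) q ag d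
... | fail , d₁ , _ = fail , e-whileTF (subst T (evalᵇ-agree b (absent-++ˡ a) ag) b-true) d₁ , tt

NoneFree : (Var → Set) → Assn → Set
NoneFree I p = ∀ {y} → I y → NotFree y p

noneFree-bound : ∀ {I x p} → NoneFree I (∃ᵃ x p) → NoneFree (λ z → I z × z ≢ x) p
noneFree-bound nf (y∈I , y≢x) with nf y∈I
... | inj₁ y≡x = ⊥-elim (y≢x y≡x)
... | inj₂ y∉p = y∉p

⊨-cong : ∀ {I} p {h h' s s'} → NoneFree I p → h ≈ʰ h' → AgreeOutside I s s' →
  (h , s) ⊨ p → (h' , s') ⊨ p
⊨-cong (bool b) nf q ag holds = subst T (evalᵇ-agree b nf ag) holds
⊨-cong (e ↪ e') nf q ag holds =
  fun-resp q (eval-agree e (proj₁ ∘ nf) ag) (trans holds (cong just (eval-agree e' (proj₂ ∘ nf) ag)))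
⊨-cong (¬ᵃ p) nf q ag holds = λ p' → holds (⊨-cong p nf (≈ʰ-sym q) (agree-sym ag) p')
⊨-cong (p ∧ᵃ p') nf q ag (holds , holds') =
  ⊨-cong p (proj₁ ∘ nf) q ag holds , ⊨-cong p' (proj₂ ∘ nf) q ag holds'
⊨-cong (p ∨ᵃ p') nf q ag (inj₁ holds) = inj₁ (⊨-cong p (proj₁ ∘ nf) q ag holds)
⊨-cong (p ∨ᵃ p') nf q ag (inj₂ holds) = inj₂ (⊨-cong p' (proj₂ ∘ nf) q ag holds)
⊨-cong (p ⇒ᵃ p') nf q ag holds =
  λ p₁ → ⊨-cong p' (proj₂ ∘ nf) q ag (holds (⊨-cong p (proj₁ ∘ nf) (≈ʰ-sym q) (agree-sym ag) p₁))
⊨-cong (∃ᵃ x p) nf q ag (v , holds) = v , ⊨-cong p (noneFree-bound {p = p} nf) q (agree-update refl ag) holds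
⊨-cong (∀ᵃ x p) nf q ag holds = λ v → ⊨-cong p (noneFree-bound {p = p} nf) q (agree-update refl ag) (holds v)
⊨-cong (p ✶ p') nf q ag (h₁ , h₂ , split , holds , holds') =
  h₁ , h₂ , split-resp {h₁ = h₁} {h₂} q split ,
  ⊨-cong p (proj₁ ∘ nf) ≈ʰ-refl ag holds , ⊨-cong p' (proj₂ ∘ nf) ≈ʰ-refl ag holds'
⊨-cong (p -✶ p') {h' = h'} nf q ag holds = λ k k' split p₁ →
  ⊨-cong p' (proj₂ ∘ nf) ≈ʰ-refl ag
    (holds k k' (split-respˡ {k'} {h'} {h₂ = k} (≈ʰ-sym q) split)
               (⊨-cong p (proj₁ ∘ nf) ≈ʰ-refl (agree-sym ag) p₁))
⊨-cong {I} ([ S ] p) {h} {h'} {s} {s'} nf q ag (no-fail , post) = no-fail' , post'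
  where
  back : ∀ {o} → Exec S h' s' o → ∃ λ o' → Exec S h s o' × Similar I o o'
  back = exec-cong (proj₁ ∘ nf) (≈ʰ-sym q) (agree-sym ag)
  no-fail' : ¬ Exec S h' s' fail
  no-fail' d with back d
  ... | fail , d₀ , _ = no-fail d₀
  post' : ∀ h₁ s₁ → Exec S h' s' (ok h₁ s₁) → (h₁ , s₁) ⊨ p
  post' h₁ s₁ d with back d
  ... | ok h₀ s₀ , d₀ , q₀ , ag₀ =
    ⊨-cong p (proj₂ ∘ nf) (≈ʰ-sym q₀) (agree-sym ag₀) (post h₀ s₀ d₀)

⊨-resp-≈ʰ : ∀ p {h h' s} → h ≈ʰ h' → (h , s) ⊨ p → (h' , s) ⊨ p
⊨-resp-≈ʰ p q = ⊨-cong {λ _ → ⊥} p (λ ()) q (mkAgree λ _ _ → refl)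

⊨-≈ʰ⇔ : ∀ p {h h' s} → h ≈ʰ h' → (h , s) ⊨ p ⇔ (h' , s) ⊨ p
⊨-≈ʰ⇔ p q = mk⇔ (⊨-resp-≈ʰ p q) (⊨-resp-≈ʰ p (≈ʰ-sym q))

⊨-agree⇔ : ∀ {I} p {h s s'} → NoneFree I p → AgreeOutside I s s' → (h , s) ⊨ p ⇔ (h , s') ⊨ p
⊨-agree⇔ p nf ag = mk⇔ (⊨-cong p nf ≈ʰ-refl ag) (⊨-cong p nf ≈ʰ-refl (agree-sym ag))

≈ʰ-↦ʰ⇔ : ∀ {h a v} → h ≈ʰ (a ↦ʰ v) ⇔ (fun h a ≡ just v × (∀ n → n ∈dom h → n ≡ a))
≈ʰ-↦ʰ⇔ {h} {a} {v} = mk⇔ (λ q → trans (≈ʰ-at q a) (upd-self ∅ʰ a v) , only-a q) singleton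
  where
  only-a : h ≈ʰ (a ↦ʰ v) → ∀ n → n ∈dom h → n ≡ a
  only-a q n n∈h with n ℤ.≟ a | ≈ʰ-at q n
  ... | yes n≡a | _ = n≡a
  ... | no _ | h[n]≡nothing = ⊥-elim (n∈h h[n]≡nothing)
  singleton : fun h a ≡ just v × (∀ n → n ∈dom h → n ≡ a) → h ≈ʰ (a ↦ʰ v)
  singleton (h[a]≡v , dom⊆a) = mk≈ʰ at
    where
    at : ∀ n → fun h n ≡ fun (a ↦ʰ v) n
    at n with n ℤ.≟ a
    ... | yes refl = h[a]≡v
    ... | no n≢a = to (¬≢nothing⇔nothing (fun h n)) (λ n∈h → n≢a (dom⊆a n n∈h))

-- Points-to assertions

⊨↪-⇔ : ∀ e {h s} → (h , s) ⊨ (e ↪-) ⇔ ⟦ e ⟧ s ∈dom h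
⊨↪-⇔ e {h} {s} = begin
    (h , s) ⊨ (e ↪-)
  ≈⟨ ∃-cong-⇔ (λ v → ≡⇒⇔ (cong₂ (λ a b → fun h a ≡ just b)
      (eval-[≔]-fresh e s v (freshFor-∉ (varsE e))) ([≔]ˢ-same s z v))) ⟩
    ∃ (λ v → fun h (⟦ e ⟧ s) ≡ just v)
  ≈⟨ ≢nothing⇔just (fun h (⟦ e ⟧ s)) ⟨
    ⟦ e ⟧ s ∈dom h
  ∎
  where z = freshFor (varsE e)

⊨¬↪-⇔ : ∀ e {h s} → (h , s) ⊨ (¬ᵃ (e ↪-)) ⇔ fun h (⟦ e ⟧ s) ≡ nothing
⊨¬↪-⇔ e {h} {s} = begin
    (h , s) ⊨ (¬ᵃ (e ↪-))
  ≈⟨ ¬-cong-⇔ (⊨↪-⇔ e {h} {s}) ⟩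
    ¬ ⟦ e ⟧ s ∈dom h
  ≈⟨ ¬≢nothing⇔nothing (fun h (⟦ e ⟧ s)) ⟩
    fun h (⟦ e ⟧ s) ≡ nothing
  ∎

⊨↦⇔ : ∀ e e' {h s} → (h , s) ⊨ (e ↦ e') ⇔ h ≈ʰ (⟦ e ⟧ s ↦ʰ ⟦ e' ⟧ s)
⊨↦⇔ e e' {h} {s} = begin
    (h , s) ⊨ (e ↦ e')
  ≈⟨ ⇔-id _ ×-⇔ ∀-cong-⇔ (λ n → →-cong-⇔ (in-dom n) (is-address n)) ⟩
    (fun h a ≡ just v × (∀ n → n ∈dom h → n ≡ a))
  ≈⟨ ≈ʰ-↦ʰ⇔ ⟨
    h ≈ʰ (a ↦ʰ v)
  ∎
  where
  a = ⟦ e ⟧ s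
  v = ⟦ e' ⟧ s
  z = freshFor (varsE e ++ varsE e')
  t = λ n → s [ z ≔ n ]ˢ
  in-dom : ∀ n → (h , t n) ⊨ (var z ↪-) ⇔ n ∈dom h
  in-dom n = begin
      (h , t n) ⊨ (var z ↪-)
    ≈⟨ ⊨↪-⇔ (var z) {h} {t n} ⟩
      t n z ∈dom h
    ≡⟨ cong (_∈dom h) ([≔]ˢ-same s z n) ⟩
      n ∈dom h
    ∎
  is-address : ∀ n → T (does (t n z ℤ.≟ ⟦ e ⟧ (t n))) ⇔ (n ≡ a)
  is-address n = begin
      T (does (t n z ℤ.≟ ⟦ e ⟧ (t n)))
    ≈⟨ T-does⇔ (t n z ℤ.≟ ⟦ e ⟧ (t n)) ⟩
      t n z ≡ ⟦ e ⟧ (t n)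
    ≡⟨ cong₂ _≡_ ([≔]ˢ-same s z n)
        (eval-[≔]-fresh e s n (freshFor-∉ (varsE e ++ varsE e') ∘ ∈-++⁺ˡ)) ⟩
      n ≡ a
    ∎

⊨↦-⇔ : ∀ e {h s} → (h , s) ⊨ (e ↦-) ⇔ ∃ λ v → h ≈ʰ (⟦ e ⟧ s ↦ʰ v)
⊨↦-⇔ e {h} {s} = ∃-cong-⇔ λ v → begin
    (h , s [ z ≔ v ]ˢ) ⊨ (e ↦ var z)
  ≈⟨ ⊨↦⇔ e (var z) {h} {s [ z ≔ v ]ˢ} ⟩
    h ≈ʰ (⟦ e ⟧ (s [ z ≔ v ]ˢ) ↦ʰ (s [ z ≔ v ]ˢ) z)
  ≡⟨ cong₂ (λ a w → h ≈ʰ (a ↦ʰ w))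
      (eval-[≔]-fresh e s v (freshFor-∉ (varsE e))) ([≔]ˢ-same s z v) ⟩
    h ≈ʰ (⟦ e ⟧ s ↦ʰ v)
  ∎
  where z = freshFor (varsE e)

⊨⟨↦-⟩✶⇔ : ∀ e q {h s} →
  (h , s) ⊨ ((e ↦-) ✶ q) ⇔ (⟦ e ⟧ s ∈dom h × (clr h (⟦ e ⟧ s) , s) ⊨ q)
⊨⟨↦-⟩✶⇔ e q {h} {s} = mk⇔ split-off-cell attach-cell
  where
  a = ⟦ e ⟧ s
  split-off-cell : (h , s) ⊨ ((e ↦-) ✶ q) → a ∈dom h × (clr h a , s) ⊨ q
  split-off-cell (h₁ , h₂ , split , cell , q-holds) with to (⊨↦-⇔ e {h₁} {s}) cell
  ... | v , h₁≈ with split-singletonʳ (split-comm {h} {h₁} {h₂} split) h₁≈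
  ...   | h₂[a]≡nothing , h≈ =
    just⇒≢nothing (trans (≈ʰ-at h≈ a) (upd-self h₂ a v)) ,
    ⊨-resp-≈ʰ q (≈ʰ-sym (≈ʰ-trans (clr-cong h≈ refl) (clr-upd v h₂[a]≡nothing))) q-holds
  attach-cell : a ∈dom h × (clr h a , s) ⊨ q → (h , s) ⊨ ((e ↦-) ✶ q)
  attach-cell (a∈h , q-holds) with to (≢nothing⇔just (fun h a)) a∈h
  ... | w , h[a]≡w =
    (a ↦ʰ w) , clr h a , split-clr {h} {a} h[a]≡w , from (⊨↦-⇔ e {a ↦ʰ w} {s}) (w , ≈ʰ-refl) , q-holds

⊨⟨↦⟩-✶⇔ : ∀ e e' q {h s} →
  (h , s) ⊨ ((e ↦ e') -✶ q) ⇔ (fun h (⟦ e ⟧ s) ≡ nothing → (upd h (⟦ e ⟧ s) (⟦ e' ⟧ s) , s) ⊨ q)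
⊨⟨↦⟩-✶⇔ e e' q {h} {s} = mk⇔ fill-cell extend
  where
  a = ⟦ e ⟧ s
  v = ⟦ e' ⟧ s
  fill-cell : (h , s) ⊨ ((e ↦ e') -✶ q) → fun h a ≡ nothing → (upd h a v , s) ⊨ q
  fill-cell wand h[a]≡nothing =
    wand (a ↦ʰ v) (upd h a v) (split-upd {h} {a} v h[a]≡nothing) (from (⊨↦⇔ e e' {a ↦ʰ v} {s}) ≈ʰ-refl)
  extend : (fun h a ≡ nothing → (upd h a v , s) ⊨ q) → (h , s) ⊨ ((e ↦ e') -✶ q)
  extend filled k h' split cell with split-singletonʳ {h'} {h} {k} split (to (⊨↦⇔ e e') cell)
  ... | h[a]≡nothing , h'≈ = ⊨-resp-≈ʰ q (≈ʰ-sym h'≈) (filled h[a]≡nothing)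

-- Weakest preconditions

⊨[≔]⇔ : ∀ {x e} p {h s} → (h , s) ⊨ ([ x ≔ e ] p) ⇔ (h , s [ x ≔ ⟦ e ⟧ s ]ˢ) ⊨ p
⊨[≔]⇔ _ = mk⇔ (λ (_ , post) → post _ _ e-assign) (λ holds → (λ ()) , λ { _ _ e-assign → holds })

⊨[≔[]]⇔ : ∀ {x e} p {h s} →
  (h , s) ⊨ ([ x ≔[ e ] ] p) ⇔ ∃ λ v → fun h (⟦ e ⟧ s) ≡ just v × (h , s [ x ≔ v ]ˢ) ⊨ p
⊨[≔[]]⇔ {x} {e} p {h} {s} = mk⇔ look-up succeed
  where
  look-up : (h , s) ⊨ ([ x ≔[ e ] ] p) → ∃ λ v → fun h (⟦ e ⟧ s) ≡ just v × (h , s [ x ≔ v ]ˢ) ⊨ p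
  look-up (no-fail , post) with fun h (⟦ e ⟧ s) in h[e]
  ... | just v = v , refl , post _ _ (e-lookup h[e])
  ... | nothing = ⊥-elim (no-fail (e-lookupF h[e]))
  succeed : (∃ λ v → fun h (⟦ e ⟧ s) ≡ just v × (h , s [ x ≔ v ]ˢ) ⊨ p) → (h , s) ⊨ ([ x ≔[ e ] ] p)
  succeed (v , h[e]≡v , holds) = no-fail , post
    where
    no-fail : ¬ Exec (x ≔[ e ]) h s fail
    no-fail (e-lookupF h[e]≡nothing) = just⇒≢nothing h[e]≡v h[e]≡nothing
    post : ∀ h' s' → Exec (x ≔[ e ]) h s (ok h' s') → (h' , s') ⊨ p
    post _ _ (e-lookup h[e]≡v') with trans (sym h[e]≡v) h[e]≡v'
    ... | refl = holds

⊨[[]≔]⇔ : ∀ {x e} p {h s} →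
  (h , s) ⊨ ([ [ x ]≔ e ] p) ⇔ (s x ∈dom h × (upd h (s x) (⟦ e ⟧ s) , s) ⊨ p)
⊨[[]≔]⇔ _ = mk⇔
  (λ (no-fail , post) → let x∈h = no-fail ∘ e-mutF in x∈h , post _ _ (e-mut x∈h))
  (λ (x∈h , holds) → (λ { (e-mutF h[x]≡nothing) → x∈h h[x]≡nothing }) , λ { _ _ (e-mut _) → holds })

⊨[cons]⇔ : ∀ {x e} p {h s} →
  (h , s) ⊨ ([ x ≔cons e ] p) ⇔ (∀ n → fun h n ≡ nothing → (upd h n (⟦ e ⟧ s) , s [ x ≔ n ]ˢ) ⊨ p)
⊨[cons]⇔ _ = mk⇔ (λ (_ , post) n h[n]≡nothing → post _ _ (e-cons h[n]≡nothing))
               (λ holds → (λ ()) , λ { _ _ (e-cons h[n]≡nothing) → holds _ h[n]≡nothing })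

⊨[dispose]⇔ : ∀ {x} p {h s} → (h , s) ⊨ ([ dispose x ] p) ⇔ (s x ∈dom h × (clr h (s x) , s) ⊨ p)
⊨[dispose]⇔ _ = mk⇔
  (λ (no-fail , post) → let x∈h = no-fail ∘ e-dispF in x∈h , post _ _ (e-disp x∈h))
  (λ (x∈h , holds) → (λ { (e-dispF h[x]≡nothing) → x∈h h[x]≡nothing }) , λ { _ _ (e-disp _) → holds })

⊨[⟨⟩≔]⇔ : ∀ {x e} p {h s} → (h , s) ⊨ ([ ⟨ x ⟩≔ e ] p) ⇔ (upd h (s x) (⟦ e ⟧ s) , s) ⊨ p
⊨[⟨⟩≔]⇔ _ = mk⇔ (λ (_ , post) → post _ _ e-hupd) (λ holds → (λ ()) , λ { _ _ e-hupd → holds })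

⊨[⟨⟩≔⊥]⇔ : ∀ {x} p {h s} → (h , s) ⊨ ([ ⟨ x ⟩≔⊥ ] p) ⇔ (clr h (s x) , s) ⊨ p
⊨[⟨⟩≔⊥]⇔ _ = mk⇔ (λ (_ , post) → post _ _ e-hclr) (λ holds → (λ ()) , λ { _ _ e-hclr → holds })

-- The equivalences (E5)–(E8)

[lookup]≣∃ : ∀ x y e p → y ∉ varsE e → NotFree y p →
  ([ x ≔[ e ] ] p) ≣ ∃ᵃ y ((e ↪ var y) ∧ᵃ ([ x ≔ var y ] p))
[lookup]≣∃ x y e p y∉e y∉p h s = ⇔-directions (begin
    (h , s) ⊨ ([ x ≔[ e ] ] p)
  ≈⟨ ⊨[≔[]]⇔ p ⟩
    (∃ λ v → fun h (⟦ e ⟧ s) ≡ just v × (h , s [ x ≔ v ]ˢ) ⊨ p)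
  ≈⟨ ∃-cong-⇔ (λ v → fetch v ×-⇔ rename v) ⟨
    (h , s) ⊨ ∃ᵃ y ((e ↪ var y) ∧ᵃ ([ x ≔ var y ] p))
  ∎)
  where
  t = λ v → s [ y ≔ v ]ˢ
  fetch : ∀ v → (fun h (⟦ e ⟧ (t v)) ≡ just (t v y)) ⇔ (fun h (⟦ e ⟧ s) ≡ just v)
  fetch v = ≡⇒⇔ (cong₂ (λ a w → fun h a ≡ just w) (eval-[≔]-fresh e s v y∉e) ([≔]ˢ-same s y v))
  rename : ∀ v → (h , t v) ⊨ ([ x ≔ var y ] p) ⇔ (h , s [ x ≔ v ]ˢ) ⊨ p
  rename v = begin
      (h , t v) ⊨ ([ x ≔ var y ] p)
    ≈⟨ ⊨[≔]⇔ p ⟩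
      (h , t v [ x ≔ t v y ]ˢ) ⊨ p
    ≈⟨ ⊨-agree⇔ p (λ { refl → y∉p })
        (agree-[≔] ([≔]ˢ-same s y v) (agree-sym (agree-[≔]ˢ s y v))) ⟩
      (h , s [ x ≔ v ]ˢ) ⊨ p
    ∎

[mutate]≣guarded : ∀ x e p → ([ [ x ]≔ e ] p) ≣ ((var x ↪-) ∧ᵃ ([ ⟨ x ⟩≔ e ] p))
[mutate]≣guarded x e p h s = ⇔-directions (begin
    (h , s) ⊨ ([ [ x ]≔ e ] p)
  ≈⟨ ⊨[[]≔]⇔ p ⟩
    (s x ∈dom h × (upd h (s x) (⟦ e ⟧ s) , s) ⊨ p)
  ≈⟨ ⊨↪-⇔ (var x) {h} {s} ×-⇔ ⊨[⟨⟩≔]⇔ p ⟨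
    (h , s) ⊨ ((var x ↪-) ∧ᵃ ([ ⟨ x ⟩≔ e ] p))
  ∎)

guarded-update≣✶-✶ : ∀ x e p →
  ((var x ↪-) ∧ᵃ ([ ⟨ x ⟩≔ e ] p)) ≣ ((var x ↦-) ✶ ((var x ↦ e) -✶ p))
guarded-update≣✶-✶ x e p h s = ⇔-directions (begin
    (h , s) ⊨ ((var x ↪-) ∧ᵃ ([ ⟨ x ⟩≔ e ] p))
  ≈⟨ ⊨↪-⇔ (var x) {h} {s} ×-⇔ ⊨[⟨⟩≔]⇔ p ⟩
    (a ∈dom h × (upd h a v , s) ⊨ p)
  ≈⟨ ⇔-id _ ×-⇔ ⊨-≈ʰ⇔ p (upd-clr h a v) ⟨
    (a ∈dom h × (upd h⁻ a v , s) ⊨ p)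
  ≈⟨ ⇔-id _ ×-⇔ mk⇔ (λ filled _ → filled) (λ filled → filled (clr-self h a)) ⟩
    (a ∈dom h × (fun h⁻ a ≡ nothing → (upd h⁻ a v , s) ⊨ p))
  ≈⟨ ⇔-id _ ×-⇔ ⊨⟨↦⟩-✶⇔ (var x) e p ⟨
    (a ∈dom h × (h⁻ , s) ⊨ ((var x ↦ e) -✶ p))
  ≈⟨ ⊨⟨↦-⟩✶⇔ (var x) ((var x ↦ e) -✶ p) {h} {s} ⟨
    (h , s) ⊨ ((var x ↦-) ✶ ((var x ↦ e) -✶ p))
  ∎)
  where
  a = s x
  v = ⟦ e ⟧ s
  h⁻ = clr h a

[cons]≣∀fresh : ∀ x e p → x ∉ varsE e →
  ([ x ≔cons e ] p) ≣ ∀ᵃ x ((¬ᵃ (var x ↪-)) ⇒ᵃ ([ ⟨ x ⟩≔ e ] p))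
[cons]≣∀fresh x e p x∉e h s = ⇔-directions (begin
    (h , s) ⊨ ([ x ≔cons e ] p)
  ≈⟨ ⊨[cons]⇔ p ⟩
    (∀ n → fun h n ≡ nothing → (upd h n (⟦ e ⟧ s) , t n) ⊨ p)
  ≈⟨ ∀-cong-⇔ (λ n → →-cong-⇔ (unallocated n) (allocate n)) ⟨
    (h , s) ⊨ ∀ᵃ x ((¬ᵃ (var x ↪-)) ⇒ᵃ ([ ⟨ x ⟩≔ e ] p))
  ∎)
  where
  t = λ n → s [ x ≔ n ]ˢ
  unallocated : ∀ n → (h , t n) ⊨ (¬ᵃ (var x ↪-)) ⇔ (fun h n ≡ nothing)
  unallocated n = begin
      (h , t n) ⊨ (¬ᵃ (var x ↪-))
    ≈⟨ ⊨¬↪-⇔ (var x) {h} {t n} ⟩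
      fun h (t n x) ≡ nothing
    ≡⟨ cong (λ a → fun h a ≡ nothing) ([≔]ˢ-same s x n) ⟩
      fun h n ≡ nothing
    ∎
  allocate : ∀ n → (h , t n) ⊨ ([ ⟨ x ⟩≔ e ] p) ⇔ (upd h n (⟦ e ⟧ s) , t n) ⊨ p
  allocate n = begin
      (h , t n) ⊨ ([ ⟨ x ⟩≔ e ] p)
    ≈⟨ ⊨[⟨⟩≔]⇔ p ⟩
      (upd h (t n x) (⟦ e ⟧ (t n)) , t n) ⊨ p
    ≡⟨ cong₂ (λ a v → (upd h a v , t n) ⊨ p)
        ([≔]ˢ-same s x n) (eval-[≔]-fresh e s n x∉e) ⟩
      (upd h n (⟦ e ⟧ s) , t n) ⊨ p
    ∎

∀fresh-update≣∀-✶ : ∀ x e p →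
  ∀ᵃ x ((¬ᵃ (var x ↪-)) ⇒ᵃ ([ ⟨ x ⟩≔ e ] p)) ≣ ∀ᵃ x ((var x ↦ e) -✶ p)
∀fresh-update≣∀-✶ x e p h s = ⇔-directions (∀-cong-⇔ λ n → begin
    (h , t n) ⊨ ((¬ᵃ (var x ↪-)) ⇒ᵃ ([ ⟨ x ⟩≔ e ] p))
  ≈⟨ →-cong-⇔ (⊨¬↪-⇔ (var x) {h} {t n}) (⊨[⟨⟩≔]⇔ p) ⟩
    (fun h (t n x) ≡ nothing → (upd h (t n x) (⟦ e ⟧ (t n)) , t n) ⊨ p)
  ≈⟨ ⊨⟨↦⟩-✶⇔ (var x) e p ⟨
    (h , t n) ⊨ ((var x ↦ e) -✶ p)
  ∎)
  where t = λ n → s [ x ≔ n ]ˢ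

[dispose]≣guarded : ∀ x p → ([ dispose x ] p) ≣ ((var x ↪-) ∧ᵃ ([ ⟨ x ⟩≔⊥ ] p))
[dispose]≣guarded x p h s = ⇔-directions (begin
    (h , s) ⊨ ([ dispose x ] p)
  ≈⟨ ⊨[dispose]⇔ p ⟩
    (s x ∈dom h × (clr h (s x) , s) ⊨ p)
  ≈⟨ ⊨↪-⇔ (var x) {h} {s} ×-⇔ ⊨[⟨⟩≔⊥]⇔ p ⟨
    (h , s) ⊨ ((var x ↪-) ∧ᵃ ([ ⟨ x ⟩≔⊥ ] p))
  ∎)

guarded-clear≣✶ : ∀ x p → ((var x ↪-) ∧ᵃ ([ ⟨ x ⟩≔⊥ ] p)) ≣ ((var x ↦-) ✶ p)
guarded-clear≣✶ x p h s = ⇔-directions (begin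
    (h , s) ⊨ ((var x ↪-) ∧ᵃ ([ ⟨ x ⟩≔⊥ ] p))
  ≈⟨ ⊨↪-⇔ (var x) {h} {s} ×-⇔ ⊨[⟨⟩≔⊥]⇔ p ⟩
    (s x ∈dom h × (clr h (s x) , s) ⊨ p)
  ≈⟨ ⊨⟨↦-⟩✶⇔ (var x) p ⟨
    (h , s) ⊨ ((var x ↦-) ✶ p)
  ∎)

lemma3p3 :
    -- (E5)
    (∀ (x y : Var) (e : Expr) (p : Assn) → y ≢ x → y ∉ varsE e → NotFree y p →
       ([ x ≔[ e ] ] p) ≣ ∃ᵃ y ((e ↪ var y) ∧ᵃ ([ x ≔ var y ] p)))
    -- (E6)
    × (∀ (x : Var) (e : Expr) (p : Assn) →
       (([ [ x ]≔ e ] p) ≣ ((var x ↪-) ∧ᵃ ([ ⟨ x ⟩≔ e ] p)))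
       × (((var x ↪-) ∧ᵃ ([ ⟨ x ⟩≔ e ] p)) ≣ ((var x ↦-) ✶ ((var x ↦ e) -✶ p))))
    -- (E7)
    × (∀ (x : Var) (e : Expr) (p : Assn) → x ∉ varsE e →
       (([ x ≔cons e ] p) ≣ ∀ᵃ x ((¬ᵃ (var x ↪-)) ⇒ᵃ ([ ⟨ x ⟩≔ e ] p)))
       × (∀ᵃ x ((¬ᵃ (var x ↪-)) ⇒ᵃ ([ ⟨ x ⟩≔ e ] p)) ≣ ∀ᵃ x ((var x ↦ e) -✶ p)))
    -- (E8)
    × (∀ (x : Var) (p : Assn) →
       (([ dispose x ] p) ≣ ((var x ↪-) ∧ᵃ ([ ⟨ x ⟩≔⊥ ] p)))
       × (((var x ↪-) ∧ᵃ ([ ⟨ x ⟩≔⊥ ] p)) ≣ ((var x ↦-) ✶ p)))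
lemma3p3 =
  -- (E5) holds without the hypothesis y ≢ x.
  (λ x y e p _ → [lookup]≣∃ x y e p) ,
  (λ x e p → [mutate]≣guarded x e p , guarded-update≣✶-✶ x e p) ,
  (λ x e p x∉e → [cons]≣∀fresh x e p x∉e , ∀fresh-update≣∀-✶ x e p) ,
  (λ x p → [dispose]≣guarded x p , guarded-clear≣✶ x p)
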